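{- Let $\mathcal{C}\subseteq 2^{[n]}$ and $\mathcal{D}\subseteq 2^{[m]}$ be neural codes and let $f:\mathcal{C}\to\mathcal{D}$ be a morphism. If $\mathcal{C}$ is a complete code, then $f(\mathcal{C})=\{f(c)\mid c\in\mathcal{C}\}$ is a complete code.
   Context: A neural code on $n$ neurons is a collection of subsets of $[n]$. The codeword containment graph $G_\mathcal{C}$ of a code $\mathcal{C}$ is the undirected simple graph with vertex set $\mathcal{C}$ in which $\sigma,\tau$ are adjacent iff $\sigma\subsetneq\tau$ or $\tau\subsetneq\sigma$. A code is complete if $G_\mathcal{C}$ is a complete graph, i.e. any two distinct codewords are comparable under strict inclusion. For $\sigma\subseteq[n]$, the trunk of $\sigma$ in $\mathcal{C}$ is $\mathrm{Tk}_\mathcal{C}(\sigma)=\{c\in\mathcal{C}\mid \sigma\subseteq c\}$; a subset of $\mathcal{C}$ is a trunk in $\mathcal{C}$ if it is empty or equals $\mathrm{Tk}_\mathcal{C}(\sigma)$ for some $\sigma\subseteq[n]$. A function $f:\mathcal{C}\to\mathcal{D}$ is a morphism if for every trunk $T\subseteq\mathcal{D}$ the preimage $f^{ -1}(T)$ is a trunk in $\mathcal{C}$. -}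

module Defs where

open import Data.Nat using (ℕ)
open import Data.Bool using (Bool; true)
open import Data.Fin.Subset using (Subset; _⊆_; _⊂_)
open import Data.Product using (Σ; ∃; _,_; proj₁)
open import Data.Sum using (_⊎_)
open import Data.Empty using (⊥)
open import Relation.Nullary using (¬_)
open import Relation.Binary.PropositionalEquality using (_≡_)
open import Function.Bundles using (_⇔_)

-- A neural code on n neurons: a collection of subsets of [n] = Fin n,
-- given by its (Bool-valued) characteristic function on 2^[n].
Code : ℕ → Set
Code n = Subset n → Bool

Codeword : {n : ℕ} → Code n → Set
Codeword {n} C = Σ (Subset n) (λ c → C c ≡ true)

IsCompleteSet : {n : ℕ} → (Subset n → Set) → Set
IsCompleteSet {n} S =
  (σ τ : Subset n) → S σ → S τ → ¬ (σ ≡ τ) → (σ ⊂ τ) ⊎ (τ ⊂ σ)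

IsComplete : {n : ℕ} → Code n → Set
IsComplete C = IsCompleteSet (λ c → C c ≡ true)

Tk : {n : ℕ} (C : Code n) → Subset n → Codeword C → Set
Tk C σ c = σ ⊆ proj₁ c

-- A subset T of C (a predicate on codewords) is a trunk in C if it is empty
-- or equals Tk_C(σ) for some σ ⊆ [n]  (equality of subsets = same members).
IsTrunk : {n : ℕ} (C : Code n) → (Codeword C → Set) → Set
IsTrunk {n} C T =
  ((c : Codeword C) → ¬ T c)
  ⊎ Σ (Subset n) (λ σ → (c : Codeword C) → T c ⇔ Tk C σ c)

IsMorphism : {n m : ℕ} (C : Code n) (D : Code m) → (Codeword C → Codeword D) → Set₁
IsMorphism C D f =
  (T : Codeword D → Set) → IsTrunk D T → IsTrunk C (λ c → T (f c))

Image : {n m : ℕ} {C : Code n} {D : Code m} →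
        (Codeword C → Codeword D) → Subset m → Set
Image {C = C} f x = ∃ (λ (c : Codeword C) → proj₁ (f c) ≡ x)

-- A morphism of codes is monotone: the preimage of the trunk of f(c) contains c, so it is the
-- trunk of some σ ⊆ c, and hence contains every codeword above c. A complete code is a chain
-- under ⊆, monotone maps send chains to chains, and a chain is a complete set.
module Submission where

open import Data.Nat using (ℕ)
open import Data.Bool using (true; _≟_)
open import Data.Fin.Subset using (Subset; _⊆_; _⊂_)
open import Data.Fin.Subset.Properties using (_∈?_; ⊆-refl; ⊆-antisym)
open import Data.Fin.Properties using (any?)
open import Data.Vec.Properties using (≡-dec)
open import Data.Product using (_,_; proj₁; proj₂)
open import Data.Sum as Sum using (_⊎_; inj₁; inj₂)
open import Data.Empty using (⊥-elim)
open import Function using (_∘_; id)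
open import Function.Bundles using (mk⇔; Equivalence)
open import Relation.Nullary using (yes; no; ¬?)
open import Relation.Nullary.Decidable using (_×-dec_)
open import Relation.Nullary.Negation using (contradiction)
open import Relation.Binary.PropositionalEquality using (_≡_; _≢_; refl; sym)
open import Defs

⊆∧≢⇒⊂ : {k : ℕ} {p q : Subset k} → p ⊆ q → p ≢ q → p ⊂ q
⊆∧≢⇒⊂ {p = p} {q} p⊆q p≢q with any? (λ x → (x ∈? q) ×-dec ¬? (x ∈? p))
... | yes (x , x∈q , x∉p) = p⊆q , x , x∈q , x∉p
... | no ∄x = contradiction (⊆-antisym p⊆q q⊆p) p≢q
  where
  q⊆p : q ⊆ p
  q⊆p {x} x∈q with x ∈? p
  ... | yes x∈p = x∈p
  ... | no x∉p = contradiction (x , x∈q , x∉p) ∄x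

IsChain : {k : ℕ} → (Subset k → Set) → Set
IsChain {k} S = (σ τ : Subset k) → S σ → S τ → σ ⊆ τ ⊎ τ ⊆ σ

module _ {k : ℕ} {S : Subset k → Set} where

  complete⇒chain : IsCompleteSet S → IsChain S
  complete⇒chain complete σ τ σ∈S τ∈S with ≡-dec _≟_ σ τ
  ... | yes refl = inj₁ ⊆-refl
  ... | no σ≢τ = Sum.map proj₁ proj₁ (complete σ τ σ∈S τ∈S σ≢τ)

  chain⇒complete : IsChain S → IsCompleteSet S
  chain⇒complete chain σ τ σ∈S τ∈S σ≢τ with chain σ τ σ∈S τ∈S
  ... | inj₁ σ⊆τ = inj₁ (⊆∧≢⇒⊂ σ⊆τ σ≢τ)
  ... | inj₂ τ⊆σ = inj₂ (⊆∧≢⇒⊂ τ⊆σ (σ≢τ ∘ sym))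

Tk-isTrunk : {n : ℕ} (C : Code n) (σ : Subset n) → IsTrunk C (Tk C σ)
Tk-isTrunk C σ = inj₂ (σ , λ _ → mk⇔ id id)

module _ {n m : ℕ} {C : Code n} {D : Code m} {f : Codeword C → Codeword D} where

  morphism-monotone : IsMorphism C D f →
    (c c′ : Codeword C) → proj₁ c ⊆ proj₁ c′ → proj₁ (f c) ⊆ proj₁ (f c′)
  morphism-monotone isMorphism c c′ c⊆c′
    with isMorphism (Tk D (proj₁ (f c))) (Tk-isTrunk D (proj₁ (f c)))
  ... | inj₁ empty = ⊥-elim (empty c ⊆-refl)
  ... | inj₂ (σ , preimage≡Tkσ) =
    Equivalence.from (preimage≡Tkσ c′) (c⊆c′ ∘ Equivalence.to (preimage≡Tkσ c) ⊆-refl)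

  monotone-image-chain :
    ((c c′ : Codeword C) → proj₁ c ⊆ proj₁ c′ → proj₁ (f c) ⊆ proj₁ (f c′)) →
    IsChain (λ c → C c ≡ true) → IsChain (Image {C = C} {D = D} f)
  monotone-image-chain monotone chain _ _ (c , refl) (c′ , refl) =
    Sum.map (monotone c c′) (monotone c′ c) (chain _ _ (proj₂ c) (proj₂ c′))

mainTheorem4 : {n m : ℕ} (C : Code n) (D : Code m)
    (f : Codeword C → Codeword D) →
    IsMorphism C D f → IsComplete C → IsCompleteSet (Image {C = C} {D = D} f)
mainTheorem4 C D f isMorphism complete =
  chain⇒complete
    (monotone-image-chain {f = f} (morphism-monotone isMorphism) (complete⇒chain complete))
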